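{- Let $\Gamma$ be a graph satisfying (P) and (N), let $\mathbb{H}$ be a $\{2,3\}$-hypergraph on $\mathfrak{C}(\Gamma)$ satisfying (E), and fix isomorphisms $\varphi_C:P_{v(C)}\to C$ for $C\in\mathfrak{C}(\Gamma)$. If $\mathbb{C}$ is a connected component of $\mathbb{H}$, then $\overline{V(\mathbb{C})}$ and $V(\Gamma\bullet\mathbb{H})\setminus\overline{V(\mathbb{C})}$ are modules of $\Gamma\bullet\mathbb{H}$.
   Context: All structures are finite. A hypergraph $H$ has vertex set $V(H)$ and edge set $E(H)\subseteq 2^{V(H)}\setminus\{\emptyset\}$; $v(H)=|V(H)|$; 3-hypergraph: all edges have 3 elements; $\{2,3\}$-hypergraph: all edges have 2 or 3 elements. $M\subseteq V(H)$ is a module of $H$ if for each $e\in E(H)$ with $e\cap M\neq\emptyset$, $e\setminus M\neq\emptyset$ there is $m\in M$ with $e\cap M=\{m\}$ and $(e\setminus\{m\})\cup\{n\}\in E(H)$ for all $n\in M$. A connected component of a hypergraph $\mathbb{H}$ is the induced subhypergraph on the vertex set of a connected component of the graph on $V(\mathbb{H})$ in which distinct vertices are adjacent iff they lie in a common edge. For $\mathbb{W}\subseteq V(\mathbb{H})=\mathfrak{C}(\Gamma)$, $\overline{\mathbb{W}}=\bigcup_{C\in\mathbb{W}}V(C)$. For a tournament $T$, $C_3(T)$ is the 3-hypergraph on $V(T)$ whose edges are the 3-sets inducing a 3-cycle. $L_m$: tournament on $\{0,\dots,m-1\}$ with arcs $ij$ for $i<j$; $U_{2n+1}$: obtained from $L_{2n+1}$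 by reversing all arcs between two even vertices. Construction. $P_n$ is the path on $\{0,\ldots,n-1\}$ with edges $\{k,k+1\}$. For a graph $\Gamma$: $\mathfrak{C}(\Gamma)$ its components; $\mathfrak{C}_{\rm even}(\Gamma)$, $\mathfrak{C}_{\rm odd}(\Gamma)$ those with even/odd number of vertices; $\mathfrak{C}_1(\Gamma)$ the one-vertex components; $w(C)=\lfloor v(C)/2\rfloor$. (P): every component is a path. (N): $\mathfrak{C}(\Gamma)\setminus\mathfrak{C}_1(\Gamma)\neq\emptyset$; for each odd $C$, if $V(\Gamma)\setminus V(C)\neq\emptyset$ then $(\mathfrak{C}(\Gamma)\setminus\mathfrak{C}_1(\Gamma))\setminus\{C\}\neq\emptyset$; for each even $C$, if $|V(\Gamma)\setminus V(C)|\ge2$ then $(\mathfrak{C}(\Gamma)\setminus\mathfrak{C}_1(\Gamma))\setminus\{C\}\neq\emptyset$. (E): each 2-element edge of $\mathbb{H}$ contains one even and one odd component; each 3-element edge consists of odd components. $\Gamma\bullet\mathbb{H}$ is the 3-hypergraph on $V(\Gamma)$ whose edge set is the union of: (i) for each $C\in\mathfrak{C}_{\rm odd}(\Gamma)\setminus\mathfrak{C}_1(\Gamma)$, $\varphi_C(E(C_3(U_{v(C)})))$; (ii) for each edge $\{C,D\}$ of $\mathbb{H}$, $C$ even, $D$ odd, the sets $\{\varphi_C(2i),\varphi_C(2j+1),\varphi_D(2k)\}$, $0\le i\le j\le w(C)-1$, $0\le k\le w(D)$; (iii) for each edge $\{I,J,K\}$ of $\mathbb{H}$, the sets $\{\varphi_I(2i),\varphi_J(2j),\varphi_K(2k)\}$,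 $0\le i\le w(I)$, $0\le j\le w(J)$, $0\le k\le w(K)$. -}

module Defs where

open import Data.Nat using (ℕ; suc; _*_; _+_; _<_; _≤_)
open import Data.Fin using (Fin; toℕ)
open import Data.Fin.Subset using (Subset; _∈_; _∪_; _∩_; _─_; ⁅_⁆; ∁; Nonempty; ∣_∣; inside)
open import Data.Vec using (tabulate; lookup)
open import Data.Product using (Σ; ∃; ∃-syntax; _×_; _,_)
open import Data.Sum using (_⊎_)
open import Relation.Nullary using (¬_)
open import Relation.Binary.PropositionalEquality using (_≡_; _≢_)
open import Relation.Binary.Construct.Closure.ReflexiveTransitive using (Star)
open import Function.Bundles using (_⇔_)

Even : ℕ → Set
Even n = ∃[ i ] n ≡ 2 * i

Odd : ℕ → Set
Odd n = ∃[ i ] n ≡ 2 * i + 1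

record Graph (n : ℕ) : Set₁ where
  field
    Adj    : Fin n → Fin n → Set
    sym    : ∀ {x y} → Adj x y → Adj y x
    irrefl : ∀ {x} → ¬ Adj x x

-- The connected components of Γ, labelled by Fin m:
-- comp x is (the label of) the component containing x.
record Components {n : ℕ} (Γ : Graph n) (m : ℕ) : Set₁ where
  field
    comp      : Fin n → Fin m
    comp-surj : ∀ (c : Fin m) → ∃[ x ] comp x ≡ c
    comp-conn : ∀ x y → (comp x ≡ comp y) ⇔ Star (Graph.Adj Γ) x y

PathAdj : {k : ℕ} → Fin k → Fin k → Set
PathAdj i j = suc (toℕ i) ≡ toℕ j ⊎ suc (toℕ j) ≡ toℕ i

-- Fixed isomorphisms φ_C : P_{v(C)} → C for every component C.
-- (Their existence is exactly condition (P).)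
record PathIsos {n m : ℕ} {Γ : Graph n} (K : Components Γ m) : Set₁ where
  open Components K
  field
    v       : Fin m → ℕ
    φ       : (c : Fin m) → Fin (v c) → Fin n
    φ-inj   : ∀ c {i j} → φ c i ≡ φ c j → i ≡ j
    φ-into  : ∀ c i → comp (φ c i) ≡ c
    φ-onto  : ∀ x → ∃[ i ] φ (comp x) i ≡ x
    φ-adj   : ∀ c i j → Graph.Adj Γ (φ c i) (φ c j) ⇔ PathAdj i j

Hypergraph : ℕ → Set₁
Hypergraph n = Subset n → Set

Is23Hypergraph : {n : ℕ} → Hypergraph n → Set
Is23Hypergraph H = ∀ e → H e → ∣ e ∣ ≡ 2 ⊎ ∣ e ∣ ≡ 3

IsModule : {n : ℕ} → Hypergraph n → Subset n → Set
IsModule H M =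
  ∀ e → H e → Nonempty (e ∩ M) → Nonempty (e ─ M) →
  ∃[ x ] (x ∈ M × e ∩ M ≡ ⁅ x ⁆ × (∀ y → y ∈ M → H ((e ─ ⁅ x ⁆) ∪ ⁅ y ⁆)))

HAdj : {n : ℕ} → Hypergraph n → Fin n → Fin n → Set
HAdj H a b = a ≢ b × ∃[ e ] (H e × a ∈ e × b ∈ e)

IsComponentVertexSet : {n : ℕ} → Hypergraph n → Subset n → Set
IsComponentVertexSet H S = ∃[ a ] (a ∈ S × ∀ b → (b ∈ S) ⇔ Star (HAdj H) a b)

triple : {n : ℕ} → Fin n → Fin n → Fin n → Subset n
triple a b c = ⁅ a ⁆ ∪ ⁅ b ⁆ ∪ ⁅ c ⁆

pair : {n : ℕ} → Fin n → Fin n → Subset n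
pair a b = ⁅ a ⁆ ∪ ⁅ b ⁆

UArc : {k : ℕ} → Fin k → Fin k → Set
UArc i j = (toℕ i < toℕ j × ¬ (Even (toℕ i) × Even (toℕ j)))
         ⊎ (toℕ j < toℕ i × Even (toℕ i) × Even (toℕ j))

C3UEdgeVia : {k n : ℕ} → (Fin k → Fin n) → Subset n → Set
C3UEdgeVia {k} f e =
  ∃[ a ] ∃[ b ] ∃[ c ] (UArc {k} a b × UArc b c × UArc c a × e ≡ triple (f a) (f b) (f c))

module _ {n m : ℕ} {Γ : Graph n} {K : Components Γ m} (Φ : PathIsos K) where
  open PathIsos Φ

  ConditionN : Set
  ConditionN =
    (∃[ c ] v c ≢ 1)
    × (∀ C → Odd (v C) → (∃[ x ] Components.comp K x ≢ C) → ∃[ D ] (D ≢ C × v D ≢ 1))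
    × (∀ C → Even (v C) →
         (∃[ x ] ∃[ y ] (x ≢ y × Components.comp K x ≢ C × Components.comp K y ≢ C)) →
         ∃[ D ] (D ≢ C × v D ≢ 1))

  ConditionE : Hypergraph m → Set
  ConditionE ℍ =
    (∀ e → ℍ e → ∣ e ∣ ≡ 2 → ∃[ C ] ∃[ D ] (C ∈ e × D ∈ e × Even (v C) × Odd (v D)))
    × (∀ e → ℍ e → ∣ e ∣ ≡ 3 → ∀ C → C ∈ e → Odd (v C))

  data BulletEdge (ℍ : Hypergraph m) : Subset n → Set where
    edge-i   : ∀ C e → Odd (v C) → v C ≢ 1 → C3UEdgeVia (φ C) e → BulletEdge ℍ e
    edge-ii  : ∀ C D → ℍ (pair C D) → Even (v C) → Odd (v D) →
               ∀ (a b : Fin (v C)) (d : Fin (v D)) (i j k : ℕ) →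
               toℕ a ≡ 2 * i → toℕ b ≡ 2 * j + 1 → toℕ d ≡ 2 * k → i ≤ j →
               BulletEdge ℍ (triple (φ C a) (φ C b) (φ D d))
    edge-iii : ∀ I J L → I ≢ J → J ≢ L → I ≢ L → ℍ (triple I J L) →
               ∀ (a : Fin (v I)) (b : Fin (v J)) (d : Fin (v L)) (i j k : ℕ) →
               toℕ a ≡ 2 * i → toℕ b ≡ 2 * j → toℕ d ≡ 2 * k →
               BulletEdge ℍ (triple (φ I a) (φ J b) (φ L d))

  overline : Subset m → Subset n
  overline W = tabulate (λ x → lookup W (Components.comp K x))

{-# OPTIONS --safe #-}
module Submission where

-- Every edge of Γ • ℍ lies inside the union of the components of Γ that belong to a single
-- connected component of ℍ: an edge of type (i) lies in one component C, one of type (ii)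
-- in C ∪ D for an edge {C, D} of ℍ, and one of type (iii) in I ∪ J ∪ K for an edge
-- {I, J, K} of ℍ. Hence no edge meets both \overline{V(ℂ)} and its complement, and both
-- are modules for the trivial reason that the module condition is never triggered.

open import Defs
open import Data.Nat using (ℕ)
open import Data.Nat.Properties using (even≢odd; +-comm)
open import Data.Fin using (Fin)
open import Data.Fin.Subset using (Subset; ∁; _∈_; _∉_; _─_; inside)
open import Data.Fin.Subset.Properties
  using (x∈⁅x⁆; x∈⁅y⁆⇒x≡y; x∈p∩q⁻; x∈p∪q⁻; x∈p∪q⁺; p─q⊆p; x∈∁p⇒x∉p; x∉p⇒x∈∁p)
open import Data.Vec using (_∷_; here; there)
open import Data.Vec.Properties using (lookup∘tabulate; []=⇒lookup; lookup⇒[]=)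
open import Data.Product using (∃-syntax; _×_; _,_; proj₁; proj₂)
open import Data.Sum using (inj₁; inj₂)
open import Data.Empty using (⊥-elim)
open import Relation.Nullary using (¬_)
open import Relation.Binary.PropositionalEquality using (_≢_; refl; sym; trans)
open import Relation.Binary.Construct.Closure.ReflexiveTransitive using (Star; ε; _◅_; _◅◅_; revApp)
open import Function.Bundles using (Equivalence)

Even⇒¬Odd : ∀ {k} → Even k → ¬ Odd k
Even⇒¬Odd (i , refl) (j , o) = even≢odd i j (trans o (+-comm _ 1))

x∈p─q⇒x∉q : ∀ {n} {x : Fin n} (p q : Subset n) → x ∈ p ─ q → x ∉ q
x∈p─q⇒x∉q (_ ∷ p) (_ ∷ q)      (there x∈p─q) (there x∈q) = x∈p─q⇒x∉q p q x∈p─q x∈q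
x∈p─q⇒x∉q (_ ∷ p) (inside ∷ q) ()            here

module _ {n : ℕ} where

  x∈pair⁺ˡ : (a b : Fin n) → a ∈ pair a b
  x∈pair⁺ˡ a b = x∈p∪q⁺ (inj₁ (x∈⁅x⁆ a))

  x∈pair⁺ʳ : (a b : Fin n) → b ∈ pair a b
  x∈pair⁺ʳ a b = x∈p∪q⁺ (inj₂ (x∈⁅x⁆ b))

  x∈triple⁺₁ : (a b c : Fin n) → a ∈ triple a b c
  x∈triple⁺₁ a b c = x∈p∪q⁺ (inj₁ (x∈⁅x⁆ a))

  x∈triple⁺₂ : (a b c : Fin n) → b ∈ triple a b c
  x∈triple⁺₂ a b c = x∈p∪q⁺ (inj₂ (x∈pair⁺ˡ b c))

  x∈triple⁺₃ : (a b c : Fin n) → c ∈ triple a b c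
  x∈triple⁺₃ a b c = x∈p∪q⁺ (inj₂ (x∈pair⁺ʳ b c))

  triple-all : ∀ {p} (P : Fin n → Set p) {a b c} → P a → P b → P c →
               ∀ {x} → x ∈ triple a b c → P x
  triple-all P {a} {b} {c} pa pb pc x∈ with x∈p∪q⁻ _ _ x∈
  ... | inj₁ x∈a rewrite x∈⁅y⁆⇒x≡y a x∈a = pa
  ... | inj₂ x∈bc with x∈p∪q⁻ _ _ x∈bc
  ...   | inj₁ x∈b rewrite x∈⁅y⁆⇒x≡y b x∈b = pb
  ...   | inj₂ x∈c rewrite x∈⁅y⁆⇒x≡y c x∈c = pc

module _ {n : ℕ} (H : Hypergraph n) where

  Unsplit : Subset n → Set
  Unsplit M = ∀ e → H e → ∀ {x y} → x ∈ e → y ∈ e → x ∈ M → y ∈ M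

  unsplit⇒isModule : ∀ {M} → Unsplit M → IsModule H M
  unsplit⇒isModule {M} unsplit e He (x , x∈e∩M) (y , y∈e─M) =
    ⊥-elim (x∈p─q⇒x∉q e M y∈e─M (unsplit e He x∈e y∈e x∈M))
    where
    x∈e = proj₁ (x∈p∩q⁻ e M x∈e∩M)
    x∈M = proj₂ (x∈p∩q⁻ e M x∈e∩M)
    y∈e = p─q⊆p e M y∈e─M

  unsplit-∁ : ∀ {M} → Unsplit M → Unsplit (∁ M)
  unsplit-∁ unsplit e He x∈e y∈e x∈∁M =
    x∉p⇒x∈∁p (λ y∈M → x∈∁p⇒x∉p x∈∁M (unsplit e He y∈e x∈e y∈M))

  HAdj-sym : ∀ {a b} → HAdj H a b → HAdj H b a
  HAdj-sym (a≢b , e , He , a∈e , b∈e) = (λ b≡a → a≢b (sym b≡a)) , e , He , b∈e , a∈e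

  componentVertexSet-closed : ∀ {S} → IsComponentVertexSet H S →
                              ∀ {a b} → Star (HAdj H) a b → a ∈ S → b ∈ S
  componentVertexSet-closed (_ , _ , reach) {a} {b} a⇝b a∈S =
    Equivalence.from (reach b) (Equivalence.to (reach a) a∈S ◅◅ a⇝b)

module _ {n m : ℕ} {Γ : Graph n} {K : Components Γ m} (Φ : PathIsos K) (ℍ : Hypergraph m) where
  open PathIsos Φ
  open Components K

  ∈-overline⁻ : ∀ {S x} → x ∈ overline Φ S → comp x ∈ S
  ∈-overline⁻ {S} {x} x∈ =
    lookup⇒[]= (comp x) S (trans (sym (lookup∘tabulate _ x)) ([]=⇒lookup x∈))

  ∈-overline⁺ : ∀ {S x} → comp x ∈ S → x ∈ overline Φ S
  ∈-overline⁺ {S} {x} cx∈ =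
    lookup⇒[]= x (overline Φ S) (trans (lookup∘tabulate _ x) ([]=⇒lookup cx∈))

  _⇝_ : Fin m → Fin m → Set
  _⇝_ = Star (HAdj ℍ)

  ⇝-φ : ∀ {C D} → C ⇝ D → ∀ i → C ⇝ comp (φ D i)
  ⇝-φ {D = D} C⇝D i rewrite φ-into D i = C⇝D

  bulletEdge-anchored : ∀ {e} → BulletEdge Φ ℍ e → ∃[ C ] (∀ {x} → x ∈ e → C ⇝ comp x)
  bulletEdge-anchored (edge-i C _ _ _ (a , b , c , _ , _ , _ , refl)) =
    C , triple-all (λ x → C ⇝ comp x) (⇝-φ ε a) (⇝-φ ε b) (⇝-φ ε c)
  bulletEdge-anchored (edge-ii C D ℍCD evenC oddD a b d _ _ _ _ _ _ _) =
    C , triple-all (λ x → C ⇝ comp x) (⇝-φ ε a) (⇝-φ ε b) (⇝-φ (C~D ◅ ε) d)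
    where
    C≢D : C ≢ D
    C≢D refl = Even⇒¬Odd evenC oddD
    C~D : HAdj ℍ C D
    C~D = C≢D , pair C D , ℍCD , x∈pair⁺ˡ C D , x∈pair⁺ʳ C D
  bulletEdge-anchored (edge-iii I J L I≢J _ I≢L ℍIJL a b d _ _ _ _ _ _) =
    I , triple-all (λ x → I ⇝ comp x) (⇝-φ ε a) (⇝-φ (I~J ◅ ε) b) (⇝-φ (I~L ◅ ε) d)
    where
    I~J : HAdj ℍ I J
    I~J = I≢J , triple I J L , ℍIJL , x∈triple⁺₁ I J L , x∈triple⁺₂ I J L
    I~L : HAdj ℍ I L
    I~L = I≢L , triple I J L , ℍIJL , x∈triple⁺₁ I J L , x∈triple⁺₃ I J L

  bulletEdge-connected : ∀ {e} → BulletEdge Φ ℍ e → ∀ {x y} → x ∈ e → y ∈ e → comp x ⇝ comp y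
  bulletEdge-connected be x∈e y∈e with bulletEdge-anchored be
  ... | C , anchor = revApp (HAdj-sym ℍ) (anchor x∈e) (anchor y∈e)

  overline-unsplit : ∀ {S} → IsComponentVertexSet ℍ S → Unsplit (BulletEdge Φ ℍ) (overline Φ S)
  overline-unsplit S-comp e be x∈e y∈e x∈S̄ =
    ∈-overline⁺ (componentVertexSet-closed ℍ S-comp (bulletEdge-connected be x∈e y∈e) (∈-overline⁻ x∈S̄))

mainTheorem11 :
    ∀ {n m : ℕ} (Γ : Graph n) (K : Components Γ m) (Φ : PathIsos K) →
    ConditionN Φ →
    (ℍ : Hypergraph m) → Is23Hypergraph ℍ → ConditionE Φ ℍ →
    (S : Subset m) → IsComponentVertexSet ℍ S →
    IsModule (BulletEdge Φ ℍ) (overline Φ S) × IsModule (BulletEdge Φ ℍ) (∁ (overline Φ S))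
mainTheorem11 Γ K Φ _ ℍ _ _ S S-comp =
  unsplit⇒isModule Γ•ℍ unsplit , unsplit⇒isModule Γ•ℍ (unsplit-∁ Γ•ℍ unsplit)
  where
  Γ•ℍ : Hypergraph _
  Γ•ℍ = BulletEdge Φ ℍ

  unsplit : Unsplit Γ•ℍ (overline Φ S)
  unsplit = overline-unsplit Φ ℍ S-comp
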